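{- Let $n\ge1$, $Q\subseteq[n]\times[n]$, and $\mathtt{box}=\{\langle i,0\rangle: i\in[n]\}\cup\{\langle 0,i\rangle:0\le i\le n\}\cup\{\langle n+1,i\rangle:0\le i\le n\}$. Then there is no $\mathtt{ADD}$ gadget in $Q\cup\mathtt{box}$ if and only if $Q$ is satisfied.
   Context: For $p\in\mathbb{Z}^2$ write $p=\langle p.x,p.y\rangle$. For points $p,q$, $\square_{pq}$ is the closed axis-parallel rectangle with opposite corners $p,q$. A set $S$ is satisfied if for all $p,q\in S$, either $p,q$ share an $x$- or $y$-coordinate, or $\square_{pq}$ contains a point of $S\setminus\{p,q\}$ (boundary included). $\mathtt{ADD}$ gadget: a tuple $G=(a,b,c,d,e)$ is an $\mathtt{ADD}$ gadget in a point set $S$ if $a,b,c,d,e\in S$; $a.y>b.y>c.y=d.y=e.y$ and either $e.x<a.x=c.x<b.x=d.x$ or $e.x>a.x=c.x>b.x=d.x$; the point $f=\langle b.x,a.y\rangle\notin S$; and $S\cap\square_G=\emptyset$, where $\square_G$ is $\square_{ef}$ with all points on the lines $x=e.x$, $y=e.y$, $x=b.x$, $y=a.y$ removed. -}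

module Defs where

open import Data.Nat using (ℕ)
open import Data.Integer using (ℤ; +_; _≤_; _<_; _⊓_; _⊔_)
open import Data.Product using (_×_; ∃-syntax)
open import Data.Sum using (_⊎_)
open import Data.List using (List)
open import Data.List.Membership.Propositional using (_∈_)
open import Relation.Nullary using (¬_)
open import Relation.Binary.PropositionalEquality using (_≡_; _≢_)

record Point : Set where
  constructor ⟨_,_⟩
  field
    x : ℤ
    y : ℤ
open Point public

PointSet : Set₁
PointSet = Point → Set

InRect : Point → Point → Point → Set
InRect p q r =
  ((x p ⊓ x q) ≤ x r × x r ≤ (x p ⊔ x q)) ×
  ((y p ⊓ y q) ≤ y r × y r ≤ (y p ⊔ y q))

InOpenRect : Point → Point → Point → Set
InOpenRect p q r =
  ((x p ⊓ x q) < x r × x r < (x p ⊔ x q)) ×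
  ((y p ⊓ y q) < y r × y r < (y p ⊔ y q))

Satisfied : PointSet → Set
Satisfied S = ∀ p q → S p → S q →
  x p ≡ x q ⊎ y p ≡ y q ⊎
  (∃[ r ] (S r × r ≢ p × r ≢ q × InRect p q r))

IsADD : PointSet → Point → Point → Point → Point → Point → Set
IsADD S a b c d e =
  S a × S b × S c × S d × S e ×
  (y b < y a × y c < y b × y c ≡ y d × y d ≡ y e) ×
  ((x e < x a × x a ≡ x c × x c < x b × x b ≡ x d) ⊎
   (x a < x e × x a ≡ x c × x b < x c × x b ≡ x d)) ×
  ¬ S ⟨ x b , y a ⟩ ×
  (∀ r → S r → ¬ InOpenRect e ⟨ x b , y a ⟩ r)

HasADD : PointSet → Set
HasADD S = ∃[ a ] ∃[ b ] ∃[ c ] ∃[ d ] ∃[ e ] IsADD S a b c d e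

InGrid : ℕ → Point → Set
InGrid n p = (+ 1 ≤ x p × x p ≤ + n) × (+ 1 ≤ y p × y p ≤ + n)

InBox : ℕ → Point → Set
InBox n p =
  ((+ 1 ≤ x p × x p ≤ + n) × y p ≡ + 0) ⊎
  (x p ≡ + 0 × (+ 0 ≤ y p × y p ≤ + n)) ⊎
  (x p ≡ + (ℕ.suc n) × (+ 0 ≤ y p × y p ≤ + n))

_∈ₗ_ : Point → List Point → Set
p ∈ₗ Q = p ∈ Q

QBox : ℕ → List Point → PointSet
QBox n Q p = p ∈ Q ⊎ InBox n p

module Submission where

-- Both directions go through empty pairs: two points t, u of S on distinct rows and
-- columns whose closed rectangle contains no further point of S.  Since box lies outside
-- every rectangle spanned by points of [n] × [n], Q is satisfied exactly when no two of
-- its points form an empty pair of S.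
--   * An ADD gadget (a, b, c, d, e) yields an empty pair of points of Q: the point of S
--     nearest to b on the row of a together with the one nearest to a on the column of b.
--   * Conversely an empty pair yields a gadget by a descent: each step either exhibits a
--     gadget or produces an empty pair of smaller weight y t + y u, which is a natural
--     number, so the descent ends.
-- The geometry is developed for any "framed" finite set (one lying in a rectangle whose
-- bottom edge and side walls it contains), and reflection in the y-axis reduces every
-- construction to one orientation.

open import Defs

module EmptyRectangles where

  open import Data.Nat as ℕ using (ℕ; zero; suc)
  import Data.Nat.Properties as ℕ
  open import Data.Integer
    using (ℤ; +_; -[1+_]; -_; _+_; _≤_; _<_; _⊓_; _⊔_; ∣_∣; +≤+; +<+; _≤?_; _<?_; _≟_)
  open import Data.Integer.Properties
  open import Data.Product using (_×_; _,_; ∃; ∃₂; proj₁; proj₂)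
  open import Data.Sum using (_⊎_; inj₁; inj₂; [_,_])
  import Data.Sum as Sum
  open import Data.List using (List; map; filter; upTo; cartesianProductWith)
  open import Data.List.Membership.Propositional using (_∈_; lose; find)
  open import Data.List.Membership.Propositional.Properties
    using (∈-map⁺; ∈-filter⁺; ∈-upTo⁺; ∈-cartesianProductWith⁺)
  open import Data.List.Relation.Unary.All using (All; lookup)
  open import Data.List.Relation.Unary.All.Properties using (all-filter)
  open import Data.List.Relation.Unary.Any using (any?; satisfied)
  import Data.List.Extrema ≤-totalOrder as Extrema
  open import Data.Empty using (⊥; ⊥-elim)
  open import Function using (id; _∘_; _⇔_; mk⇔; Equivalence)
  open import Relation.Nullary using (¬_; yes; no)
  open import Relation.Nullary.Decidable using (map′; _×-dec_; _⊎-dec_; ¬?)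
  open import Relation.Unary using (Decidable; _⊆_)
  open import Relation.Binary.Definitions using (DecidableEquality; tri<; tri≈; tri>)
  open import Relation.Binary.PropositionalEquality
    using (_≡_; _≢_; refl; sym; trans; cong; subst)

  point-≡ : ∀ {p q} → x p ≡ x q → y p ≡ y q → p ≡ q
  point-≡ {⟨ _ , _ ⟩} {⟨ _ , _ ⟩} refl refl = refl

  _≟ₚ_ : DecidableEquality Point
  p ≟ₚ q with x p ≟ x q | y p ≟ y q
  ... | yes x≡ | yes y≡ = yes (point-≡ x≡ y≡)
  ... | no x≢  | _      = no (x≢ ∘ cong x)
  ... | yes _  | no y≢  = no (y≢ ∘ cong y)

  Box : (ℤ → ℤ → Set) → ℤ → ℤ → ℤ → ℤ → Point → Set
  Box R x₁ x₂ y₁ y₂ r = (R x₁ (x r) × R (x r) x₂) × (R y₁ (y r) × R (y r) y₂)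

  Within : ℤ → ℤ → ℤ → ℤ → Point → Set
  Within = Box _≤_

  -- Once their corners are sorted, the rectangles InRect p q and InOpenRect p q of Defs
  -- are boxes whose bounds are coordinates of p and q.
  Extent : ℤ → ℤ → ℤ → ℤ → Set
  Extent i j lo hi = i ⊓ j ≡ lo × i ⊔ j ≡ hi

  ascending : ∀ {i j} → i ≤ j → Extent i j i j
  ascending i≤j = i≤j⇒i⊓j≡i i≤j , i≤j⇒i⊔j≡j i≤j

  descending : ∀ {i j} → j ≤ i → Extent i j j i
  descending j≤i = i≥j⇒i⊓j≡j j≤i , i≥j⇒i⊔j≡i j≤i

  rect⇔ : ∀ {p q x₁ x₂ y₁ y₂ r} → Extent (x p) (x q) x₁ x₂ → Extent (y p) (y q) y₁ y₂ →
    InRect p q r ⇔ Within x₁ x₂ y₁ y₂ r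
  rect⇔ (refl , refl) (refl , refl) = mk⇔ id id

  open-rect⇔ : ∀ {p q x₁ x₂ y₁ y₂ r} → Extent (x p) (x q) x₁ x₂ → Extent (y p) (y q) y₁ y₂ →
    InOpenRect p q r ⇔ Box _<_ x₁ x₂ y₁ y₂ r
  open-rect⇔ (refl , refl) (refl , refl) = mk⇔ id id

  in-rect? : ∀ p q → Decidable (InRect p q)
  in-rect? p q r = ((x p ⊓ x q ≤? x r) ×-dec (x r ≤? x p ⊔ x q)) ×-dec
                   ((y p ⊓ y q ≤? y r) ×-dec (y r ≤? y p ⊔ y q))

  rect-sym : ∀ {p q r} → InRect q p r → InRect p q r
  rect-sym {p} {q} = Equivalence.to (rect⇔ (⊓-comm (x q) (x p) , ⊔-comm (x q) (x p))
                                           (⊓-comm (y q) (y p) , ⊔-comm (y q) (y p)))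

  mirror : Point → Point
  mirror p = ⟨ - x p , y p ⟩

  mirror-involutive : ∀ p → mirror (mirror p) ≡ p
  mirror-involutive p = point-≡ (neg-involutive (x p)) refl

  neg-≤-swap : ∀ {i j} → - i ≤ j → - j ≤ i
  neg-≤-swap {i} h = subst (_ ≤_) (neg-involutive i) (neg-mono-≤ h)

  ≤-neg-swap : ∀ {i j} → i ≤ - j → j ≤ - i
  ≤-neg-swap {j = j} h = subst (_≤ _) (neg-involutive j) (neg-mono-≤ h)

  neg-<-swap : ∀ {i j} → - i < j → - j < i
  neg-<-swap {i} h = subst (_ <_) (neg-involutive i) (neg-mono-< h)

  <-neg-swap : ∀ {i j} → i < - j → j < - i
  <-neg-swap {j = j} h = subst (_< _) (neg-involutive j) (neg-mono-< h)

  within-mirror : ∀ {x₁ x₂ y₁ y₂ r} → Within (- x₂) (- x₁) y₁ y₂ r → Within x₁ x₂ y₁ y₂ (mirror r)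
  within-mirror ((l , h) , ys) = (≤-neg-swap h , neg-≤-swap l) , ys

  open-mirror : ∀ {x₁ x₂ y₁ y₂ r} → Box _<_ (- x₂) (- x₁) y₁ y₂ r → Box _<_ x₁ x₂ y₁ y₂ (mirror r)
  open-mirror ((l , h) , ys) = (<-neg-swap h , neg-<-swap l) , ys

  record Mirrors (S T : PointSet) : Set where
    field
      to   : ∀ {p} → S p → T (mirror p)
      from : ∀ {p} → T p → S (mirror p)

    to⁻ : ∀ {p} → S (mirror p) → T p
    to⁻ {p} s = subst T (mirror-involutive p) (to s)

    from⁻ : ∀ {p} → T (mirror p) → S p
    from⁻ {p} t = subst S (mirror-involutive p) (from t)

  Mirror : PointSet → PointSet
  Mirror S = S ∘ mirror

  mirror-image : ∀ {S} → Mirrors S (Mirror S)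
  mirror-image {S} = record { to = λ {p} s → subst S (sym (mirror-involutive p)) s ; from = id }

  mirrors-sym : ∀ {S T} → Mirrors S T → Mirrors T S
  mirrors-sym m = record { to = Mirrors.from m ; from = Mirrors.to m }

  mirror-swap : ∀ {r p} → mirror r ≡ p → r ≡ mirror p
  mirror-swap {r} refl = sym (mirror-involutive r)

  record Framed (S : PointSet) : Set where
    field
      S?         : Decidable S
      points     : List Point
      listed     : ∀ {p} → S p → p ∈ points
      left right top : ℤ
      inside     : ∀ {p} → S p → Within left right (+ 0) top p
      base       : ∀ {i} → left < i → i < right → S ⟨ i , + 0 ⟩
      left-wall  : ∀ {j} → + 0 ≤ j → j ≤ top → S ⟨ left , j ⟩
      right-wall : ∀ {j} → + 0 ≤ j → j ≤ top → S ⟨ right , j ⟩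

  -- Points strictly inside the frame; in the application these are exactly the points of Q.
  Interior : ∀ {S} → Framed S → Point → Set
  Interior F p = left < x p × x p < right × + 0 < y p
    where open Framed F

  module _ {S} (F : Framed S) where
    open Framed F

    left≤ : ∀ {p} → S p → left ≤ x p
    left≤ Sp = proj₁ (proj₁ (inside Sp))

    ≤right : ∀ {p} → S p → x p ≤ right
    ≤right Sp = proj₂ (proj₁ (inside Sp))

    0≤height : ∀ {p} → S p → + 0 ≤ y p
    0≤height Sp = proj₁ (proj₂ (inside Sp))

    height≤top : ∀ {p} → S p → y p ≤ top
    height≤top Sp = proj₂ (proj₂ (inside Sp))

    left-of-wall : ∀ {p j} → S p → + 0 ≤ j → j ≤ top → ¬ S ⟨ x p , j ⟩ → x p < right
    left-of-wall Sp 0≤j j≤top gap =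
      ≤∧≢⇒< (≤right Sp) λ p≡right → gap (subst (λ i → S ⟨ i , _ ⟩) (sym p≡right) (right-wall 0≤j j≤top))

  mirror-framed : ∀ {S T} → Mirrors S T → Framed S → Framed T
  mirror-framed {S} {T} m F = record
    { S?         = λ p → map′ to⁻ from (S? (mirror p))
    ; points     = map mirror points
    ; listed     = λ {p} Tp → subst (_∈ map mirror points) (mirror-involutive p)
                                    (∈-map⁺ mirror (listed (from Tp)))
    ; left       = - right
    ; right      = - left
    ; top        = top
    ; inside     = λ Tp → let ((l , h) , ys) = inside (from Tp) in (neg-≤-swap h , ≤-neg-swap l) , ys
    ; base       = λ {i} l h → to⁻ {⟨ i , + 0 ⟩} (base (<-neg-swap h) (neg-<-swap l))
    ; left-wall  = λ l h → to (right-wall l h)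
    ; right-wall = λ l h → to (left-wall l h)
    }
    where open Framed F
          open Mirrors m

  interior-mirror : ∀ {S T} (m : Mirrors S T) (F : Framed S) {p} →
    Interior (mirror-framed m F) p → Interior F (mirror p)
  interior-mirror _ _ (l , h , v) = <-neg-swap h , neg-<-swap l , v

  Maximal : (Point → Set) → (Point → ℤ) → Point → Set
  Maximal P f p = P p × (∀ {q} → P q → f q ≤ f p)

  Minimal : (Point → Set) → (Point → ℤ) → Point → Set
  Minimal P f p = P p × (∀ {q} → P q → f p ≤ f q)

  module Extremes {S} (F : Framed S) where
    open Framed F

    empty-or-inhabited : ∀ {P : Point → Set} → Decidable P → P ⊆ S → (∀ {p} → ¬ P p) ⊎ ∃ P
    empty-or-inhabited P? P⊆S with any? P? points
    ... | yes found = inj₂ (satisfied found)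
    ... | no none   = inj₁ λ Pp → none (lose (listed (P⊆S Pp)) Pp)

    maximise : ∀ {P : Point → Set} → Decidable P → P ⊆ S → (f : Point → ℤ) → ∀ {p₀} → P p₀ → ∃ (Maximal P f)
    maximise P? P⊆S f {p₀} Pp₀ =
      Extrema.argmax f p₀ candidates ,
      Extrema.argmax-all f Pp₀ (all-filter P? points) ,
      λ Pq → lookup (Extrema.f[xs]≤f[argmax] p₀ candidates) (∈-filter⁺ P? (listed (P⊆S Pq)) Pq)
      where candidates = filter P? points

    minimise : ∀ {P : Point → Set} → Decidable P → P ⊆ S → (f : Point → ℤ) → ∀ {p₀} → P p₀ → ∃ (Minimal P f)
    minimise P? P⊆S f {p₀} Pp₀ =
      Extrema.argmin f p₀ candidates ,
      Extrema.argmin-all f Pp₀ (all-filter P? points) ,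
      λ Pq → lookup (Extrema.f[argmin]≤f[xs] p₀ candidates) (∈-filter⁺ P? (listed (P⊆S Pq)) Pq)
      where candidates = filter P? points

  record EmptyUL (S : PointSet) (t u : Point) : Set where
    field
      upper   : S t
      lower   : S u
      x-order : x t < x u
      y-order : y u < y t
      alone   : ∀ {r} → S r → Within (x t) (x u) (y u) (y t) r → r ≡ t ⊎ r ≡ u

  record EmptyUR (S : PointSet) (t u : Point) : Set where
    field
      upper   : S t
      lower   : S u
      x-order : x u < x t
      y-order : y u < y t
      alone   : ∀ {r} → S r → Within (x u) (x t) (y u) (y t) r → r ≡ t ⊎ r ≡ u

  EmptyPair : PointSet → Point → Point → Set
  EmptyPair S t u = EmptyUL S t u ⊎ EmptyUR S t u

  mirror-UL : ∀ {S T t u} → Mirrors S T → EmptyUL S t u → EmptyUR T (mirror t) (mirror u)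
  mirror-UL m p = record
    { upper   = to upper
    ; lower   = to lower
    ; x-order = neg-mono-< x-order
    ; y-order = y-order
    ; alone   = λ Tr w → Sum.map mirror-swap mirror-swap (alone (from Tr) (within-mirror w))
    }
    where open Mirrors m
          open EmptyUL p

  mirror-UR : ∀ {S T t u} → Mirrors S T → EmptyUR S t u → EmptyUL T (mirror t) (mirror u)
  mirror-UR m p = record
    { upper   = to upper
    ; lower   = to lower
    ; x-order = neg-mono-< x-order
    ; y-order = y-order
    ; alone   = λ Tr w → Sum.map mirror-swap mirror-swap (alone (from Tr) (within-mirror w))
    }
    where open Mirrors m
          open EmptyUR p

  mirror-pair : ∀ {S T t u} → Mirrors S T → EmptyPair S t u → EmptyPair T (mirror t) (mirror u)
  mirror-pair m (inj₁ p) = inj₂ (mirror-UL m p)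
  mirror-pair m (inj₂ p) = inj₁ (mirror-UR m p)

  corners-in : ∀ {S t u} → EmptyPair S t u → S t × S u
  corners-in (inj₁ p) = EmptyUL.upper p , EmptyUL.lower p
  corners-in (inj₂ p) = EmptyUR.upper p , EmptyUR.lower p

  pair-rect : ∀ {S t u} → EmptyPair S t u →
    x t ≢ x u × y t ≢ y u × (∀ {r} → S r → InRect t u r → r ≡ t ⊎ r ≡ u)
  pair-rect (inj₁ p) =
    (λ x≡ → <-irrefl x≡ x-order) , (λ y≡ → <-irrefl (sym y≡) y-order) ,
    λ Sr r∈ → alone Sr (Equivalence.to (rect⇔ (ascending (<⇒≤ x-order)) (descending (<⇒≤ y-order))) r∈)
    where open EmptyUL p
  pair-rect (inj₂ p) =
    (λ x≡ → <-irrefl (sym x≡) x-order) , (λ y≡ → <-irrefl (sym y≡) y-order) ,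
    λ Sr r∈ → alone Sr (Equivalence.to (rect⇔ (descending (<⇒≤ x-order)) (descending (<⇒≤ y-order))) r∈)
    where open EmptyUR p

  pair-unsatisfied : ∀ {S T : PointSet} {t u} → T ⊆ S → EmptyPair S t u → T t → T u → ¬ Satisfied T
  pair-unsatisfied T⊆S p Tt Tu sat with sat _ _ Tt Tu | pair-rect p
  ... | inj₁ x≡                                 | x≢ , _      = x≢ x≡
  ... | inj₂ (inj₁ y≡)                          | _ , y≢ , _  = y≢ y≡
  ... | inj₂ (inj₂ (r , Tr , r≢t , r≢u , r∈))   | _ , _ , alone = [ r≢t , r≢u ] (alone (T⊆S Tr) r∈)

  mirror-ADD : ∀ {S T a b c d e} → Mirrors S T → IsADD S a b c d e →
    IsADD T (mirror a) (mirror b) (mirror c) (mirror d) (mirror e)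
  mirror-ADD {a = a} {b} {c} {d} {e} m (Sa , Sb , Sc , Sd , Se , heights , orientation , f∉S , hollow) =
    to Sa , to Sb , to Sc , to Sd , to Se , heights , reverse orientation ,
    (λ Tf → f∉S (from⁻ {⟨ x b , y a ⟩} Tf)) ,
    λ r Tr r∈ → hollow (mirror r) (from Tr) (open-mirror (Equivalence.to (open-rect⇔ negated (refl , refl)) r∈))
    where
      open Mirrors m
      reverse : (x e < x a × x a ≡ x c × x c < x b × x b ≡ x d) ⊎ (x a < x e × x a ≡ x c × x b < x c × x b ≡ x d) →
        (- x e < - x a × - x a ≡ - x c × - x c < - x b × - x b ≡ - x d) ⊎
        (- x a < - x e × - x a ≡ - x c × - x b < - x c × - x b ≡ - x d)
      reverse (inj₁ (e<a , a≡c , c<b , b≡d)) = inj₂ (neg-mono-< e<a , cong -_ a≡c , neg-mono-< c<b , cong -_ b≡d)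
      reverse (inj₂ (a<e , a≡c , b<c , b≡d)) = inj₁ (neg-mono-< a<e , cong -_ a≡c , neg-mono-< b<c , cong -_ b≡d)
      negated : Extent (- x e) (- x b) (- (x e ⊔ x b)) (- (x e ⊓ x b))
      negated = sym (neg-distrib-⊔-⊓ (x e) (x b)) , sym (neg-distrib-⊓-⊔ (x e) (x b))

  mirror-HasADD : ∀ {S T} → Mirrors S T → HasADD S → HasADD T
  mirror-HasADD m (a , b , c , d , e , gadget) = _ , _ , _ , _ , _ , mirror-ADD m gadget

  -- A left-oriented ADD gadget (e left of a = c, b = d right of them) gives an empty
  -- upper-left pair of interior points: a' is the rightmost point of S on the row of a
  -- in [x a, x b), b' the highest on the column of b in [y b, y a).  The box between a'
  -- and b' avoids f = ⟨x b, y a⟩ and otherwise lies in the hollow of the gadget.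
  module LeftGadget {S} (F : Framed S) {a b e : Point}
    (Sa : S a) (Sb : S b) (Se : S e) (b<a : y b < y a) (e<b : y e < y b)
    (e<a : x e < x a) (a<b : x a < x b) (f∉S : ¬ S ⟨ x b , y a ⟩)
    (hollow : ∀ r → S r → ¬ InOpenRect e ⟨ x b , y a ⟩ r) where
    open Framed F
    open Extremes F

    RowOfA : Point → Set
    RowOfA r = S r × y r ≡ y a × x a ≤ x r × x r < x b

    ColumnOfB : Point → Set
    ColumnOfB r = S r × x r ≡ x b × y b ≤ y r × y r < y a

    b<right : x b < right
    b<right = left-of-wall F Sb (0≤height F Sa) (height≤top F Sa) f∉S

    empty-pair : ∀ {a' b'} → Maximal RowOfA x a' → Maximal ColumnOfB y b' →
      EmptyUL S a' b' × Interior F a' × Interior F b'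
    empty-pair {a'} {b'} ((Sa' , a'≡a , a≤a' , a'<b) , a'-max) ((Sb' , b'≡b , b≤b' , b'<a) , b'-max) =
      record { upper = Sa' ; lower = Sb'
             ; x-order = <-≤-trans a'<b (≤-reflexive (sym b'≡b))
             ; y-order = <-≤-trans b'<a (≤-reflexive (sym a'≡a))
             ; alone = alone } ,
      a'-interior , b'-interior
      where
        -- e is a point of S left of a' and below b'.
        a'-interior : Interior F a'
        a'-interior = <-≤-trans (≤-<-trans (left≤ F Se) e<a) a≤a' , <-trans a'<b b<right ,
                      ≤-<-trans (0≤height F Se) (<-≤-trans (<-trans e<b b<a) (≤-reflexive (sym a'≡a)))

        b'-interior : Interior F b'
        b'-interior = ≤-<-trans (left≤ F Se) (<-trans e<a (<-≤-trans a<b (≤-reflexive (sym b'≡b)))) ,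
                      ≤-<-trans (≤-reflexive b'≡b) b<right ,
                      ≤-<-trans (0≤height F Se) (<-≤-trans e<b b≤b')

        alone : ∀ {r} → S r → Within (x a') (x b') (y b') (y a') r → r ≡ a' ⊎ r ≡ b'
        alone {r} Sr ((a'≤r , r≤b') , (b'≤r , r≤a')) with y r ≟ y a | x r ≟ x b
        ... | yes r≡a | yes r≡b = ⊥-elim (f∉S (subst S (point-≡ r≡b r≡a) Sr))
        ... | yes r≡a | no  r≢b = inj₁ (point-≡ (≤-antisym (a'-max row) a'≤r) (trans r≡a (sym a'≡a)))
          where row : RowOfA r
                row = Sr , r≡a , ≤-trans a≤a' a'≤r , ≤∧≢⇒< (≤-trans r≤b' (≤-reflexive b'≡b)) r≢b
        ... | no  r≢a | yes r≡b = inj₂ (point-≡ (trans r≡b (sym b'≡b)) (≤-antisym (b'-max column) b'≤r))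
          where column : ColumnOfB r
                column = Sr , r≡b , ≤-trans b≤b' b'≤r , ≤∧≢⇒< (≤-trans r≤a' (≤-reflexive a'≡a)) r≢a
        ... | no  r≢a | no  r≢b = ⊥-elim (hollow r Sr (Equivalence.from (open-rect⇔ extent-x extent-y) inner))
          where
            extent-x : Extent (x e) (x b) (x e) (x b)
            extent-x = ascending (<⇒≤ (<-trans e<a a<b))
            extent-y : Extent (y e) (y a) (y e) (y a)
            extent-y = ascending (<⇒≤ (<-trans e<b b<a))
            inner : Box _<_ (x e) (x b) (y e) (y a) r
            inner = (<-≤-trans e<a (≤-trans a≤a' a'≤r) , ≤∧≢⇒< (≤-trans r≤b' (≤-reflexive b'≡b)) r≢b) ,
                    (<-≤-trans e<b (≤-trans b≤b' b'≤r) , ≤∧≢⇒< (≤-trans r≤a' (≤-reflexive a'≡a)) r≢a)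

    pair : ∃₂ λ t u → EmptyUL S t u × Interior F t × Interior F u
    pair with maximise row? proj₁ x (Sa , refl , ≤-refl , a<b)
            | maximise column? proj₁ y (Sb , refl , ≤-refl , b<a)
      where
        row? : Decidable RowOfA
        row? r = S? r ×-dec y r ≟ y a ×-dec x a ≤? x r ×-dec x r <? x b
        column? : Decidable ColumnOfB
        column? r = S? r ×-dec x r ≟ x b ×-dec y b ≤? y r ×-dec y r <? y a
    ... | a' , a'-max | b' , b'-max = a' , b' , empty-pair a'-max b'-max

  InteriorPair : ∀ {S} → Framed S → Set
  InteriorPair {S} F = ∃₂ λ t u → EmptyPair S t u × Interior F t × Interior F u

  left-gadget-pair : ∀ {S} (F : Framed S) {a b c d e} → IsADD S a b c d e → x e < x a →
    ∃₂ λ t u → EmptyUL S t u × Interior F t × Interior F u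
  left-gadget-pair F (_ , _ , _ , _ , _ , _ , inj₂ (a<e , _) , _) e<a = ⊥-elim (<-asym a<e e<a)
  left-gadget-pair F (Sa , Sb , _ , _ , Se , (b<a , c<b , c≡d , d≡e) , inj₁ (_ , a≡c , c<xb , _) , f∉S , hollow) e<a =
    LeftGadget.pair F Sa Sb Se b<a (≤-<-trans (≤-reflexive (sym (trans c≡d d≡e))) c<b) e<a
                    (≤-<-trans (≤-reflexive a≡c) c<xb) f∉S hollow

  gadget-pair : ∀ {S} (F : Framed S) → HasADD S → InteriorPair F
  gadget-pair F (_ , _ , _ , _ , _ , gadget@(_ , _ , _ , _ , _ , _ , inj₁ (e<a , _) , _))
    with left-gadget-pair F gadget e<a
  ... | t , u , p , it , iu = t , u , inj₁ p , it , iu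
  gadget-pair F (_ , _ , _ , _ , _ , gadget@(_ , _ , _ , _ , _ , _ , inj₂ (a<e , _) , _))
    with left-gadget-pair (mirror-framed mirror-image F) (mirror-ADD mirror-image gadget) (neg-mono-< a<e)
  ... | t , u , p , it , iu =
    mirror t , mirror u , mirror-pair (mirrors-sym mirror-image) (inj₁ p) ,
    interior-mirror mirror-image F it , interior-mirror mirror-image F iu

  Lighter : PointSet → ℤ → Set
  Lighter S w = ∃₂ λ t u → EmptyPair S t u × y t + y u < w

  Progress : PointSet → ℤ → Set
  Progress S w = HasADD S ⊎ Lighter S w

  -- Let h be the
  -- height of the highest point of S in the strip x a ≤ x < x b below b (the bottom edge
  -- guarantees one), and call the points of the strip at height h its top row.  Above h
  -- the strip contains only a.  Then:
  --   * if ⟨x b, h⟩ ∉ S, the rightmost top-row point and the lowest point of the column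
  --     x = x b above h form an empty upper-right pair;
  --   * if the leftmost top-row point c is right of a, then (a, c) is an empty pair;
  --   * otherwise c lies below a; with e the nearest point of S left of c on its row,
  --     either the pocket (x e, x a) × (h, y a) is empty and (a, b, c, ⟨x b, h⟩, e) is an
  --     ADD gadget, or its lowest-then-rightmost point forms an empty pair with c.
  module Step {S} (F : Framed S) {a b} (ab : EmptyUL S a b) where
    open Framed F
    open Extremes F
    open EmptyUL ab renaming (upper to Sa; lower to Sb; x-order to a<b; y-order to b<a; alone to only-a-b)

    -- The corner ⟨x b, y a⟩ of the box is neither a nor b, hence not in S.
    f∉S : ¬ S ⟨ x b , y a ⟩
    f∉S Sf with only-a-b Sf ((<⇒≤ a<b , ≤-refl) , (<⇒≤ b<a , ≤-refl))
    ... | inj₁ f≡a = <-irrefl (cong x (sym f≡a)) a<b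
    ... | inj₂ f≡b = <-irrefl (cong y (sym f≡b)) b<a

    not-in-box : ∀ {r} → S r → Within (x a) (x b) (y b) (y a) r → y r < y a → x r < x b → ⊥
    not-in-box Sr r∈ r<a r<b with only-a-b Sr r∈
    ... | inj₁ refl = <-irrefl refl r<a
    ... | inj₂ refl = <-irrefl refl r<b

    -- The walls and the bottom edge would otherwise put a third point into the box:
    -- a, b lie strictly inside the frame and b is above the bottom edge.
    left<a : left < x a
    left<a = ≤∧≢⇒< (left≤ F Sa) λ left≡a →
      not-in-box (left-wall (0≤height F Sb) (height≤top F Sb))
                 ((≤-reflexive (sym left≡a) , ≤-trans (≤-reflexive left≡a) (<⇒≤ a<b)) , (≤-refl , <⇒≤ b<a))
                 b<a (≤-<-trans (≤-reflexive left≡a) a<b)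

    b<right : x b < right
    b<right = left-of-wall F Sb (0≤height F Sa) (height≤top F Sa) f∉S

    0<b : + 0 < y b
    0<b = ≤∧≢⇒< (0≤height F Sb) λ 0≡b →
      not-in-box (base left<a (<-trans a<b b<right))
                 ((≤-refl , <⇒≤ a<b) , (≤-reflexive (sym 0≡b) , 0≤height F Sa))
                 (≤-<-trans (≤-reflexive 0≡b) b<a) a<b

    Below : Point → Set
    Below r = S r × x a ≤ x r × x r < x b × y r < y b

    below? : Decidable Below
    below? r = S? r ×-dec x a ≤? x r ×-dec x r <? x b ×-dec y r <? y b

    module Level {c₁} (highest : Maximal Below y c₁) where
      h : ℤ
      h = y c₁

      h<b : h < y b
      h<b = proj₂ (proj₂ (proj₂ (proj₁ highest)))

      TopRow : Point → Set
      TopRow r = Below r × y r ≡ h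

      top-row? : Decidable TopRow
      top-row? r = below? r ×-dec y r ≟ h

      top-row⊆S : TopRow ⊆ S
      top-row⊆S = proj₁ ∘ proj₁

      strip : ∀ {r} → S r → x a ≤ x r → x r < x b → h ≤ y r → y r ≤ y a → r ≡ a ⊎ TopRow r
      strip {r} Sr a≤r r<b h≤r r≤a with y r <? y b
      ... | yes r<b′ = inj₂ (below , ≤-antisym (proj₂ highest below) h≤r)
        where below : Below r
              below = Sr , a≤r , r<b , r<b′
      ... | no r≮b with only-a-b Sr ((a≤r , <⇒≤ r<b) , (≮⇒≥ r≮b , r≤a))
      ...   | inj₁ r≡a = inj₁ r≡a
      ...   | inj₂ refl = ⊥-elim (<-irrefl refl r<b)

      ColumnOfB : Point → Set
      ColumnOfB r = S r × x r ≡ x b × h < y r × y r ≤ y b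

      column? : Decidable ColumnOfB
      column? r = S? r ×-dec x r ≟ x b ×-dec h <? y r ×-dec y r ≤? y b

      column-pair : ∀ {c d} → ¬ S ⟨ x b , h ⟩ → Maximal TopRow x c → Minimal ColumnOfB y d →
        Lighter S (y a + y b)
      column-pair {c} {d} d∉S (((Sc , a≤c , c<b , c<b′) , c≡h) , rightmost) ((Sd , d≡b , h<d , d≤b) , lowest) =
        d , c , inj₂ pair , +-mono-< (≤-<-trans d≤b b<a) c<b′
        where
          -- On the column of b, ⟨x b, h⟩ is missing and d is the lowest point above h.
          on-column : ∀ {r} → S r → x r ≡ x b → h ≤ y r → y r ≤ y d → r ≡ d
          on-column {r} Sr r≡b h≤r r≤d with h <? y r
          ... | yes h<r = point-≡ (trans r≡b (sym d≡b)) (≤-antisym r≤d (lowest (Sr , r≡b , h<r , ≤-trans r≤d d≤b)))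
          ... | no h≮r = ⊥-elim (d∉S (subst S (point-≡ r≡b (≤-antisym (≮⇒≥ h≮r) h≤r)) Sr))

          -- Left of the column of b the box meets the strip only in the top row, from c on.
          alone : ∀ {r} → S r → Within (x c) (x d) (y c) (y d) r → r ≡ d ⊎ r ≡ c
          alone {r} Sr ((c≤r , r≤d) , (c≤r′ , r≤d′)) with x r <? x b
          ... | yes r<b with strip Sr (≤-trans a≤c c≤r) r<b (≤-trans (≤-reflexive (sym c≡h)) c≤r′)
                                   (≤-trans r≤d′ (≤-trans d≤b (<⇒≤ b<a)))
          ...   | inj₁ r≡a = ⊥-elim (<-irrefl (cong y r≡a) (≤-<-trans (≤-trans r≤d′ d≤b) b<a))
          ...   | inj₂ row = inj₂ (point-≡ (≤-antisym (rightmost row) c≤r) (trans (proj₂ row) (sym c≡h)))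
          alone {r} Sr ((c≤r , r≤d) , (c≤r′ , r≤d′)) | no r≮b =
            inj₁ (on-column Sr (≤-antisym (≤-trans r≤d (≤-reflexive d≡b)) (≮⇒≥ r≮b))
                               (≤-trans (≤-reflexive (sym c≡h)) c≤r′) r≤d′)

          pair : EmptyUR S d c
          pair = record
            { upper = Sd ; lower = Sc
            ; x-order = <-≤-trans c<b (≤-reflexive (sym d≡b))
            ; y-order = ≤-<-trans (≤-reflexive c≡h) h<d
            ; alone = alone }

      corner-pair : ∀ {c} → Minimal TopRow x c → x a < x c → Lighter S (y a + y b)
      corner-pair {c} (((Sc , _ , c<b , c<b′) , c≡h) , leftmost) a<c =
        a , c , inj₁ pair , +-monoʳ-< (y a) c<b′
        where
          alone : ∀ {r} → S r → Within (x a) (x c) (y c) (y a) r → r ≡ a ⊎ r ≡ c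
          alone {r} Sr ((a≤r , r≤c) , (c≤r , r≤a))
            with strip Sr a≤r (≤-<-trans r≤c c<b) (≤-trans (≤-reflexive (sym c≡h)) c≤r) r≤a
          ... | inj₁ r≡a = inj₁ r≡a
          ... | inj₂ row = inj₂ (point-≡ (≤-antisym r≤c (leftmost row)) (trans (proj₂ row) (sym c≡h)))

          pair : EmptyUL S a c
          pair = record
            { upper = Sa ; lower = Sc ; x-order = a<c ; y-order = <-trans c<b′ b<a ; alone = alone }

      module BelowA {c} (d∈S : S ⟨ x b , h ⟩) (c-row : TopRow c) (c≡a : x c ≡ x a) where
        Sc : S c
        Sc = proj₁ (proj₁ c-row)

        c<b : x c < x b
        c<b = proj₁ (proj₂ (proj₂ (proj₁ c-row)))

        c≡h : y c ≡ h
        c≡h = proj₂ c-row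

        LeftOfC : Point → Set
        LeftOfC r = S r × y r ≡ h × x r < x a

        left-of-c? : Decidable LeftOfC
        left-of-c? r = S? r ×-dec y r ≟ h ×-dec x r <? x a

        wall-point : LeftOfC ⟨ left , h ⟩
        wall-point = left-wall (0≤height F Sc₁) (height≤top F Sc₁) , refl , left<a
          where Sc₁ = proj₁ (proj₁ highest)

        module Nearest {e} (nearest : Maximal LeftOfC x e) where
          Se : S e
          Se = proj₁ (proj₁ nearest)

          e≡h : y e ≡ h
          e≡h = proj₁ (proj₂ (proj₁ nearest))

          e<a : x e < x a
          e<a = proj₂ (proj₂ (proj₁ nearest))

          Pocket : Point → Set
          Pocket r = S r × x e < x r × x r < x a × h < y r × y r < y a

          pocket? : Decidable Pocket
          pocket? r = S? r ×-dec x e <? x r ×-dec x r <? x a ×-dec h <? y r ×-dec y r <? y a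

          gadget : (∀ {r} → ¬ Pocket r) → IsADD S a b c ⟨ x b , h ⟩ e
          gadget empty =
            Sa , Sb , Sc , d∈S , Se , (b<a , ≤-<-trans (≤-reflexive c≡h) h<b , c≡h , sym e≡h) ,
            inj₁ (e<a , sym c≡a , c<b , refl) , f∉S , hollow
            where
              -- Left of a the hollow is the pocket; from x a on, it lies in the strip above h.
              hollow : ∀ r → S r → ¬ InOpenRect e ⟨ x b , y a ⟩ r
              hollow r Sr r∈ with Equivalence.to (open-rect⇔ (ascending (<⇒≤ (<-trans e<a a<b)))
                                    (ascending (≤-trans (≤-reflexive e≡h) (<⇒≤ (<-trans h<b b<a))))) r∈
              ... | (e<r , r<b) , (e<r′ , r<a) with x r <? x a
              ...   | yes r<a′ = empty (Sr , e<r , r<a′ , ≤-<-trans (≤-reflexive (sym e≡h)) e<r′ , r<a)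
              ...   | no r≮a with strip Sr (≮⇒≥ r≮a) r<b (≤-trans (≤-reflexive (sym e≡h)) (<⇒≤ e<r′)) (<⇒≤ r<a)
              ...     | inj₁ r≡a = <-irrefl (cong y r≡a) r<a
              ...     | inj₂ row = <-irrefl (trans e≡h (sym (proj₂ row))) e<r′

          PocketRow : Point → Point → Set
          PocketRow r₁ r = Pocket r × y r ≡ y r₁

          pocket-row? : ∀ r₁ → Decidable (PocketRow r₁)
          pocket-row? r₁ r = pocket? r ×-dec y r ≟ y r₁

          pocket-pair : ∀ {r₁ r₂} → Minimal Pocket y r₁ → Maximal (PocketRow r₁) x r₂ → Lighter S (y a + y b)
          pocket-pair {r₁} {r₂} (_ , lowest) (((Sr₂ , e<r₂ , r₂<a , h<r₂ , r₂<a′) , r₂≡r₁) , rightmost) =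
            r₂ , c , inj₁ pair , +-mono-< r₂<a′ (≤-<-trans (≤-reflexive c≡h) h<b)
            where
              -- Left of a and above h the box lies in the pocket, where only r₂ reaches it;
              -- at height h it is right of e; on the column of a it is in the strip.
              alone : ∀ {r} → S r → Within (x r₂) (x c) (y c) (y r₂) r → r ≡ r₂ ⊎ r ≡ c
              alone {r} Sr ((r₂≤r , r≤c) , (c≤r , r≤r₂)) with x r <? x a | h <? y r
              ... | yes r<a | yes h<r =
                inj₁ (point-≡ (≤-antisym (rightmost (pocket , same-row)) r₂≤r) (trans same-row (sym r₂≡r₁)))
                where
                  pocket : Pocket r
                  pocket = Sr , <-≤-trans e<r₂ r₂≤r , r<a , h<r , ≤-<-trans r≤r₂ r₂<a′
                  same-row : y r ≡ y r₁
                  same-row = ≤-antisym (≤-trans r≤r₂ (≤-reflexive r₂≡r₁)) (lowest pocket)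
              ... | yes r<a | no h≮r =
                ⊥-elim (<-irrefl refl (≤-<-trans (proj₂ nearest (Sr , r≡h , r<a)) (<-≤-trans e<r₂ r₂≤r)))
                where
                  r≡h : y r ≡ h
                  r≡h = ≤-antisym (≮⇒≥ h≮r) (≤-trans (≤-reflexive (sym c≡h)) c≤r)
              ... | no r≮a | _
                with strip Sr (≮⇒≥ r≮a) (≤-<-trans r≤c c<b) (≤-trans (≤-reflexive (sym c≡h)) c≤r)
                           (≤-trans r≤r₂ (<⇒≤ r₂<a′))
              ...   | inj₁ r≡a = ⊥-elim (<-irrefl (cong y r≡a) (≤-<-trans r≤r₂ r₂<a′))
              ...   | inj₂ row = inj₂ (point-≡ (≤-antisym r≤c (≤-trans (≤-reflexive c≡a) (≮⇒≥ r≮a)))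
                                               (trans (proj₂ row) (sym c≡h)))

              pair : EmptyUL S r₂ c
              pair = record
                { upper = Sr₂ ; lower = Sc
                ; x-order = <-≤-trans r₂<a (≤-reflexive (sym c≡a))
                ; y-order = ≤-<-trans (≤-reflexive c≡h) h<r₂
                ; alone = alone }

          progress : Progress S (y a + y b)
          progress with empty-or-inhabited pocket? proj₁
          ... | inj₁ empty = inj₁ (_ , _ , _ , _ , _ , gadget empty)
          ... | inj₂ (_ , in-pocket) with minimise pocket? proj₁ y in-pocket
          ...   | r₁ , lowest with maximise (pocket-row? r₁) (proj₁ ∘ proj₁) x (proj₁ lowest , refl)
          ...     | r₂ , rightmost = inj₂ (pocket-pair lowest rightmost)

        progress : Progress S (y a + y b)
        progress with maximise left-of-c? proj₁ x wall-point
        ... | _ , nearest = Nearest.progress nearest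

      c₁-row : TopRow c₁
      c₁-row = proj₁ highest , refl

      progress : Progress S (y a + y b)
      progress with S? ⟨ x b , h ⟩
      ... | no d∉S with maximise top-row? top-row⊆S x c₁-row | minimise column? proj₁ y (Sb , refl , h<b , ≤-refl)
      ...   | _ , rightmost | _ , lowest = inj₂ (column-pair d∉S rightmost lowest)
      progress | yes d∈S with minimise top-row? top-row⊆S x c₁-row
      ...   | c , leftmost@(c-row , _) with x a <? x c
      ...     | yes a<c = inj₂ (corner-pair leftmost a<c)
      ...     | no a≮c = BelowA.progress d∈S c-row (≤-antisym (≮⇒≥ a≮c) (proj₁ (proj₂ (proj₁ c-row))))

    progress : Progress S (y a + y b)
    progress with maximise below? proj₁ y (base left<a (<-trans a<b b<right) , ≤-refl , a<b , 0<b)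
    ... | _ , highest = Level.progress highest

  progress : ∀ {S} → Framed S → ∀ {t u} → EmptyPair S t u → Progress S (y t + y u)
  progress F (inj₁ p) = Step.progress F p
  progress F (inj₂ p) with Step.progress (mirror-framed mirror-image F) (mirror-UR mirror-image p)
  ... | inj₁ gadget = inj₁ (mirror-HasADD (mirrors-sym mirror-image) gadget)
  ... | inj₂ (t , u , q , lighter) = inj₂ (mirror t , mirror u , mirror-pair (mirrors-sym mirror-image) q , lighter)

  ∣∣-mono-< : ∀ {i j} → + 0 ≤ i → i < j → ∣ i ∣ ℕ.< ∣ j ∣
  ∣∣-mono-< (+≤+ _) (+<+ m<n) = m<n

  -- Weights are non-negative and strictly decrease, so the descent ends in a gadget.
  pair→ADD : ∀ {S} → Framed S → ∀ {t u} → EmptyPair S t u → HasADD S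
  pair→ADD {S} F p = descend (suc _) p (ℕ.n<1+n _)
    where
      weight≥0 : ∀ {t u} → EmptyPair S t u → + 0 ≤ y t + y u
      weight≥0 p = let (St , Su) = corners-in p in +-mono-≤ (0≤height F St) (0≤height F Su)

      descend : ∀ m {t u} → EmptyPair S t u → ∣ y t + y u ∣ ℕ.< m → HasADD S
      descend (suc m) p w<m with progress F p
      ... | inj₁ gadget = gadget
      ... | inj₂ (_ , _ , p′ , lighter) = descend m p′ (ℕ.<-≤-trans (∣∣-mono-< (weight≥0 p′) lighter) (ℕ.s≤s⁻¹ w<m))

  module Grid (n : ℕ) (Q : List Point) (Q-in-grid : All (InGrid n) Q) where
    open import Data.List.Membership.DecPropositional _≟ₚ_ using (_∈?_)

    S : PointSet
    S = QBox n Q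

    in-box? : Decidable (InBox n)
    in-box? p = ((+ 1 ≤? x p ×-dec x p ≤? + n) ×-dec y p ≟ + 0) ⊎-dec
                (x p ≟ + 0 ×-dec (+ 0 ≤? y p ×-dec y p ≤? + n)) ⊎-dec
                (x p ≟ + suc n ×-dec (+ 0 ≤? y p ×-dec y p ≤? + n))

    0≤ : ∀ {k} → + 0 ≤ + k
    0≤ = +≤+ ℕ.z≤n

    top≤right : + n ≤ + suc n
    top≤right = +≤+ (ℕ.n≤1+n n)

    1≰0 : ¬ (+ 1 ≤ + 0)
    1≰0 (+≤+ ())

    inside : ∀ {p} → S p → Within (+ 0) (+ suc n) (+ 0) (+ n) p
    inside (inj₁ p∈Q) with lookup Q-in-grid p∈Q
    ... | (l , h) , (l′ , h′) = (≤-trans 0≤ l , ≤-trans h top≤right) , (≤-trans 0≤ l′ , h′)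
    inside (inj₂ (inj₁ ((l , h) , y≡0))) =
      (≤-trans 0≤ l , ≤-trans h top≤right) , (≤-reflexive (sym y≡0) , ≤-trans (≤-reflexive y≡0) 0≤)
    inside (inj₂ (inj₂ (inj₁ (x≡0 , ys)))) = (≤-reflexive (sym x≡0) , ≤-trans (≤-reflexive x≡0) 0≤) , ys
    inside (inj₂ (inj₂ (inj₂ (x≡ , ys)))) = (≤-trans 0≤ (≤-reflexive (sym x≡)) , ≤-reflexive x≡) , ys

    grid : List Point
    grid = cartesianProductWith (λ i j → ⟨ + i , + j ⟩) (upTo (suc (suc n))) (upTo (suc n))

    in-grid : ∀ {p} → Within (+ 0) (+ suc n) (+ 0) (+ n) p → p ∈ grid
    in-grid {⟨ + i , + j ⟩} ((_ , +≤+ i≤) , (_ , +≤+ j≤)) =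
      ∈-cartesianProductWith⁺ _ (∈-upTo⁺ (ℕ.s≤s i≤)) (∈-upTo⁺ (ℕ.s≤s j≤))
    in-grid {⟨ -[1+ _ ] , _ ⟩} ((() , _) , _)
    in-grid {⟨ + _ , -[1+ _ ] ⟩} (_ , (() , _))

    base : ∀ {i} → + 0 < i → i < + suc n → S ⟨ i , + 0 ⟩
    base (+<+ 0<k) (+<+ k<1+n) = inj₂ (inj₁ ((+≤+ 0<k , +≤+ (ℕ.s≤s⁻¹ k<1+n)) , refl))

    framed : Framed S
    framed = record
      { S?         = λ p → (p ∈? Q) ⊎-dec in-box? p
      ; points     = grid
      ; listed     = in-grid ∘ inside
      ; left       = + 0
      ; right      = + suc n
      ; top        = + n
      ; inside     = inside
      ; base       = base
      ; left-wall  = λ l h → inj₂ (inj₂ (inj₁ (refl , l , h)))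
      ; right-wall = λ l h → inj₂ (inj₂ (inj₂ (refl , l , h)))
      }

    interior∈Q : ∀ {p} → Interior framed p → S p → p ∈ Q
    interior∈Q _ (inj₁ p∈Q) = p∈Q
    interior∈Q (_ , _ , 0<y) (inj₂ (inj₁ (_ , y≡0))) = ⊥-elim (<-irrefl (sym y≡0) 0<y)
    interior∈Q (0<x , _ , _) (inj₂ (inj₂ (inj₁ (x≡0 , _)))) = ⊥-elim (<-irrefl (sym x≡0) 0<x)
    interior∈Q (_ , x<r , _) (inj₂ (inj₂ (inj₂ (x≡r , _)))) = ⊥-elim (<-irrefl x≡r x<r)

    box-avoids-grid : ∀ {x₁ x₂ y₁ y₂ r} → + 1 ≤ x₁ → x₂ ≤ + n → + 1 ≤ y₁ →
      Within x₁ x₂ y₁ y₂ r → ¬ InBox n r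
    box-avoids-grid _ _ 1≤y ((_ , _) , (y≤r , _)) (inj₁ (_ , r≡0)) =
      1≰0 (≤-trans 1≤y (≤-trans y≤r (≤-reflexive r≡0)))
    box-avoids-grid 1≤x _ _ ((x≤r , _) , _) (inj₂ (inj₁ (r≡0 , _))) =
      1≰0 (≤-trans 1≤x (≤-trans x≤r (≤-reflexive r≡0)))
    box-avoids-grid _ x≤n _ ((_ , r≤x) , _) (inj₂ (inj₂ (r≡1+n , _)))
      with ≤-trans (≤-reflexive (sym r≡1+n)) (≤-trans r≤x x≤n)
    ... | +≤+ 1+n≤n = ℕ.1+n≰n 1+n≤n

    -- If the rectangle of p, q ∈ Q holds no further point of Q, it holds no further point
    -- of S either, since box lies outside [n] × [n].
    module Lonely {p q} (p∈Q : p ∈ Q) (q∈Q : q ∈ Q)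
                  (lonely : ∀ {r} → r ∈ Q → r ≢ p → r ≢ q → ¬ InRect p q r) where
      only-corners : ∀ {x₁ x₂ y₁ y₂} → (∀ {r} → Within x₁ x₂ y₁ y₂ r → InRect p q r) →
        + 1 ≤ x₁ → x₂ ≤ + n → + 1 ≤ y₁ → ∀ {r} → S r → Within x₁ x₂ y₁ y₂ r → r ≡ p ⊎ r ≡ q
      only-corners as-rect 1≤x x≤n 1≤y {r} Sr r∈ with r ≟ₚ p | r ≟ₚ q | Sr
      ... | yes r≡p | _       | _         = inj₁ r≡p
      ... | no _    | yes r≡q | _         = inj₂ r≡q
      ... | no r≢p  | no r≢q  | inj₁ r∈Q  = ⊥-elim (lonely r∈Q r≢p r≢q (as-rect r∈))
      ... | no _    | no _    | inj₂ r∈box = ⊥-elim (box-avoids-grid 1≤x x≤n 1≤y r∈ r∈box)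

      lonely-pair : y q < y p → x p ≢ x q → EmptyPair S p q
      lonely-pair q<p x≢ with <-cmp (x p) (x q) | lookup Q-in-grid p∈Q | lookup Q-in-grid q∈Q
      ... | tri≈ _ x≡ _ | _ | _ = ⊥-elim (x≢ x≡)
      ... | tri< p<q _ _ | (1≤p , _) , _ | (_ , q≤n) , (1≤q , _) = inj₁ record
        { upper = inj₁ p∈Q ; lower = inj₁ q∈Q ; x-order = p<q ; y-order = q<p
        ; alone = only-corners (Equivalence.from (rect⇔ (ascending (<⇒≤ p<q)) (descending (<⇒≤ q<p))))
                               1≤p q≤n 1≤q }
      ... | tri> _ _ q<p′ | (_ , p≤n) , _ | (1≤q , _) , (1≤q′ , _) = inj₂ record
        { upper = inj₁ p∈Q ; lower = inj₁ q∈Q ; x-order = q<p′ ; y-order = q<p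
        ; alone = only-corners (Equivalence.from (rect⇔ (descending (<⇒≤ q<p′)) (descending (<⇒≤ q<p))))
                               1≤q p≤n 1≤q′ }

    -- A gadget gives an empty pair of interior points, that is of points of Q.
    satisfied→no-ADD : Satisfied (_∈ₗ Q) → ¬ HasADD S
    satisfied→no-ADD sat gadget with gadget-pair framed gadget
    ... | _ , _ , p , t-interior , u-interior =
      pair-unsatisfied inj₁ p (interior∈Q t-interior St) (interior∈Q u-interior Su) sat
      where St = proj₁ (corners-in p)
            Su = proj₂ (corners-in p)

    -- Two points of Q off each other's row and column, with no witness in their rectangle,
    -- form an empty pair of S, which the descent turns into a gadget.
    no-ADD→satisfied : ¬ HasADD S → Satisfied (_∈ₗ Q)
    no-ADD→satisfied no-gadget p q p∈Q q∈Q
      with x p ≟ x q | y p ≟ y q | any? (λ r → ¬? (r ≟ₚ p) ×-dec ¬? (r ≟ₚ q) ×-dec in-rect? p q r) Q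
    ... | yes x≡ | _      | _         = inj₁ x≡
    ... | no _   | yes y≡ | _         = inj₂ (inj₁ y≡)
    ... | no _   | no _   | yes found = inj₂ (inj₂ (let (r , r∈Q , w) = find found in r , r∈Q , w))
    ... | no x≢  | no y≢  | no none   = ⊥-elim (no-gadget (pair→ADD framed (proj₂ (proj₂ pair))))
      where
        lonely : ∀ {r} → r ∈ Q → r ≢ p → r ≢ q → ¬ InRect p q r
        lonely r∈Q r≢p r≢q r∈ = none (lose r∈Q (r≢p , r≢q , r∈))

        pair : ∃₂ (EmptyPair S)
        pair with <-cmp (y p) (y q)
        ... | tri> _ _ q<p = _ , _ , Lonely.lonely-pair p∈Q q∈Q lonely q<p x≢
        ... | tri≈ _ y≡ _ = ⊥-elim (y≢ y≡)
        ... | tri< p<q _ _ = _ , _ , Lonely.lonely-pair q∈Q p∈Q (λ r∈Q r≢q r≢p → lonely r∈Q r≢p r≢q ∘ rect-sym)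
                                                         p<q (x≢ ∘ sym)

open import Data.Nat using (ℕ; _≤_)
open import Data.List using (List)
open import Data.List.Relation.Unary.All using (All)
open import Relation.Nullary using (¬_)
open import Function.Bundles using (_⇔_; mk⇔)

mainTheorem9 : (n : ℕ) → 1 ≤ n → (Q : List Point) → All (InGrid n) Q →
    (¬ HasADD (QBox n Q)) ⇔ Satisfied (λ p → p ∈ₗ Q)
mainTheorem9 n _ Q Q-in-grid = mk⇔ no-ADD→satisfied satisfied→no-ADD
  where open EmptyRectangles.Grid n Q Q-in-grid
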